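{- Let $\mathcal P$ and $\mathcal Q$ be $n$-polytopes. Let $\Phi,\Phi'$ be flags of $\mathcal P$ lying in flag orbits $\mathcal O_1,\mathcal O_1'$ respectively, and let $\Psi,\Psi'$ be flags of $\mathcal Q$ lying in flag orbits $\mathcal O_2,\mathcal O_2'$ respectively. Then there is a path from $(\mathcal O_1,\mathcal O_2)$ to $(\mathcal O_1',\mathcal O_2')$ in $T(\mathcal P)\diamond T(\mathcal Q)$ if and only if there is $w\in W$ with $w^{ -1}\mathrm{Stab}_W(\Phi)w=\mathrm{Stab}_W(\Phi')$ and $w^{ -1}\mathrm{Stab}_W(\Psi)w=\mathrm{Stab}_W(\Psi')$.
   Context: An $n$-polytope is an abstract polytope of rank $n$; for a flag $\Phi$ and $i\in\{0,\dots,n-1\}$, $\Phi^i$ is the unique flag differing from $\Phi$ only in its $i$-face. $W=\langle r_0,\dots,r_{n-1}\rangle$ is the Coxeter group with relations $r_i^2=1$ and $(r_ir_j)^2=1$ for $|i-j|\ge2$, acting on flags by $r_i\Phi=\Phi^i$; $\mathrm{Stab}_W(\Phi)$ is the stabilizer. Flag orbits are orbits of the automorphism group. The symmetry type graph $T(\mathcal P)$ has one vertex per flag orbit and an $i$-edge between the orbits of $\Phi$ and $\Phi^i$ (a semi-edge if they coincide). $T(\mathcal P)\diamond T(\mathcal Q)$ is the graph on $V(T(\mathcal P))\times V(T(\mathcal Q))$ in which $(u_1,v_1)$ and $(u_2,v_2)$ are joined by an $i$-edge iff $u_1,u_2$ are joined by an $i$-edge (or $i$-semi-edge if $u_1=u_2$)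 in $T(\mathcal P)$ and likewise $v_1,v_2$ in $T(\mathcal Q)$. -}

module Defs where

open import Data.Nat as ℕ using (ℕ; zero; suc)
open import Data.Fin as Fin using (Fin; toℕ; fromℕ; inject₁)
open import Data.Product using (Σ; ∃; ∃-syntax; ∃₂; _×_; _,_)
open import Data.Sum using (_⊎_)
open import Data.List using (List; []; _∷_; _++_; reverse)
open import Relation.Binary.PropositionalEquality using (_≡_; _≢_)
open import Relation.Binary.Structures using (IsPartialOrder)
open import Function.Bundles using (_⇔_)

-- Ranked (graded) posets of rank n.
-- Ranks -1, 0, ..., n are encoded by Fin (2 + n): index k means rank k - 1.

record GradedPoset (n : ℕ) : Set₁ where
  field
    Face           : Set
    _≤_            : Face → Face → Set
    isPartialOrder : IsPartialOrder _≡_ _≤_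

  _<_ : Face → Face → Set
  F < G = F ≤ G × F ≢ G

  field
    rank       : Face → Fin (2 ℕ.+ n)
    rank-mono  : ∀ {F G} → F < G → rank F Fin.< rank G
    minFace    : Face
    maxFace    : Face
    minFace-≤  : ∀ F → minFace ≤ F
    ≤-maxFace  : ∀ F → F ≤ maxFace
    rank-min   : rank minFace ≡ Fin.zero
    rank-max   : rank maxFace ≡ fromℕ (suc n)
    -- every maximal chain contains one face of each rank
    graded     : ∀ {F G} → F < G → suc (suc (toℕ (rank F))) ℕ.≤ toℕ (rank G) →
                 ∃[ H ] (F < H × H < G)

module _ {n : ℕ} (P : GradedPoset n) where
  open GradedPoset P

  record Flag : Set where
    field
      face      : Fin (2 ℕ.+ n) → Face
      face-rank : ∀ k → rank (face k) ≡ k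
      face-mono : ∀ k l → k Fin.≤ l → face k ≤ face l

  open Flag public

  _≈F_ : Flag → Flag → Set
  Φ ≈F Ψ = ∀ k → face Φ k ≡ face Ψ k

  DiffersAt : Fin (2 ℕ.+ n) → Flag → Flag → Set
  DiffersAt p Φ Ψ = face Φ p ≢ face Ψ p × (∀ k → k ≢ p → face Φ k ≡ face Ψ k)

  Adjacent : Flag → Flag → Set
  Adjacent Φ Ψ = ∃[ p ] DiffersAt p Φ Ψ

  data FlagPath (C : Flag → Set) : Flag → Flag → Set where
    done : ∀ {X Y} → X ≈F Y → FlagPath C X Y
    next : ∀ {X Y Z} → Adjacent X Y → C Y → FlagPath C Y Z → FlagPath C X Z

  StronglyFlagConnected : Set
  StronglyFlagConnected = ∀ Φ Ψ →
    FlagPath (λ X → ∀ k → face Φ k ≡ face Ψ k → face X k ≡ face Φ k) Φ Ψ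

  DiamondCondition : Set
  DiamondCondition = ∀ {F G} → F ≤ G → toℕ (rank G) ≡ 2 ℕ.+ toℕ (rank F) →
    ∃₂ λ H₁ H₂ → H₁ ≢ H₂ × (F < H₁ × H₁ < G) × (F < H₂ × H₂ < G) ×
                 (∀ H → F < H → H < G → H ≡ H₁ ⊎ H ≡ H₂)

  record Automorphism : Set where
    field
      fun     : Face → Face
      inv     : Face → Face
      inv-l   : ∀ F → inv (fun F) ≡ F
      inv-r   : ∀ F → fun (inv F) ≡ F
      mono    : ∀ {F G} → F ≤ G → fun F ≤ fun G
      reflect : ∀ {F G} → fun F ≤ fun G → F ≤ G

record Polytope (n : ℕ) : Set₁ where
  field
    poset   : GradedPoset n
    diamond : DiamondCondition poset
    sfc     : StronglyFlagConnected poset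

module _ {n : ℕ} (𝓟 : Polytope n) where
  open Polytope 𝓟

  PFlag : Set
  PFlag = Flag poset

  -- Ψ = Φ^i  (i-adjacent: differ exactly in the i-face; position suc i encodes rank i)
  IAdj : Fin n → PFlag → PFlag → Set
  IAdj i Φ Ψ = DiffersAt poset (Fin.suc (inject₁ i)) Φ Ψ

  -- Elements of W written as words r_{i₁} ⋯ r_{iₖ}  (list [i₁ , … , iₖ])
  -- Acts w Φ Ψ  means  w Φ = Ψ  (the rightmost generator acts first)
  Acts : List (Fin n) → PFlag → PFlag → Set
  Acts []      Φ Ψ = _≈F_ poset Φ Ψ
  Acts (i ∷ w) Φ Ψ = ∃[ Χ ] (Acts w Φ Χ × IAdj i Χ Ψ)

  InStab : List (Fin n) → PFlag → Set
  InStab u Φ = Acts u Φ Φ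

  -- w⁻¹ Stab_W(Φ) w = Stab_W(Φ')   (w⁻¹ = reverse w since generators are involutions)
  ConjStab : List (Fin n) → PFlag → PFlag → Set
  ConjStab w Φ Φ' = ∀ u → InStab (w ++ u ++ reverse w) Φ ⇔ InStab u Φ'

  SameOrbit : PFlag → PFlag → Set
  SameOrbit Φ Ψ = Σ (Automorphism poset) λ γ →
    ∀ k → Automorphism.fun γ (face Φ k) ≡ face Ψ k

  TEdge : Fin n → PFlag → PFlag → Set
  TEdge i Φ₁ Φ₂ = ∃₂ λ Φ Χ → SameOrbit Φ₁ Φ × IAdj i Φ Χ × SameOrbit Χ Φ₂

-- Paths in T(𝓟) ◇ T(𝓠); vertices (pairs of orbits) represented by pairs of flags
module _ {n : ℕ} (𝓟 𝓠 : Polytope n) where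

  DEdge : Fin n → PFlag 𝓟 × PFlag 𝓠 → PFlag 𝓟 × PFlag 𝓠 → Set
  DEdge i (Φ₁ , Ψ₁) (Φ₂ , Ψ₂) = TEdge 𝓟 i Φ₁ Φ₂ × TEdge 𝓠 i Ψ₁ Ψ₂

  data DPath : PFlag 𝓟 × PFlag 𝓠 → PFlag 𝓟 × PFlag 𝓠 → Set where
    stay : ∀ {Φ Φ' Ψ Ψ'} → SameOrbit 𝓟 Φ Φ' → SameOrbit 𝓠 Ψ Ψ' →
           DPath (Φ , Ψ) (Φ' , Ψ')
    step : ∀ {a b c} (i : Fin n) → DEdge i a b → DPath b c → DPath a c

-- By the diamond condition every flag X has exactly one i-adjacent flag adj i X, so
-- words w over the generators of W act on flags, and the action commutes with
-- automorphisms. A path in T(𝓟) ◇ T(𝓠) from (Φ , Ψ) to (Φ′ , Ψ′) therefore exists iff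
-- one word w⁻¹ moves Φ into the orbit of Φ′ and Ψ into the orbit of Ψ′: follow the
-- path edge by edge, or the word letter by letter. Since w⁻¹ Stab(Φ) w = Stab(w⁻¹ Φ),
-- it remains to see that flags with the same stabiliser lie in one orbit. Send the
-- face at position k of u · X to the face at position k of u · Y. If u · X and v · X
-- share that face, strong flag connectivity gives a word t not moving position k
-- with t u · X = v · X; then v⁻¹ t u ∈ Stab(X) = Stab(Y), so u · Y and v · Y share
-- their faces at position k as well, and the map is well defined.

module Submission where

open import Defs
open import Data.Nat as ℕ using (ℕ; zero; suc; _+_; _∸_; z≤n)
import Data.Nat.Properties as ℕₚ
open import Data.Fin as Fin using (Fin; toℕ; fromℕ; inject₁)
import Data.Fin.Properties as Finₚ
open import Data.Fin.Relation.Unary.Top using (view; ‵fromℕ; ‵inj₁)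
open import Data.Product using (proj₁; proj₂; ∃-syntax; _×_; _,_)
open import Data.Sum using (_⊎_; inj₁; inj₂)
open import Data.Empty using (⊥-elim)
open import Relation.Nullary using (¬_; Dec; yes; no)
open import Relation.Binary.PropositionalEquality
  using (_≡_; _≢_; refl; sym; trans; cong; subst; subst₂; module ≡-Reasoning)
open import Relation.Binary.Structures using (IsPartialOrder)
open import Relation.Binary.Bundles using (Setoid)
open import Level using (0ℓ)
open import Function.Bundles using (_⇔_; mk⇔; Equivalence)
open import Function.Properties.Equivalence using () renaming (sym to ⇔-sym; trans to ⇔-trans)
import Relation.Binary.Reasoning.Setoid as SetoidReasoning
open import Data.List using (List; []; _∷_; _++_; [_]; reverse)
import Data.List.Properties as Listₚ
open import Data.List.Relation.Unary.All using (All; []; _∷_)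
import Data.List.Relation.Unary.All.Properties as Allₚ

module _ {A : Set} where

  OneOf : A → A → A → Set
  OneOf a b x = x ≡ a ⊎ x ≡ b

  oneOf-other : ∀ {a b x} → a ≢ b → OneOf a b x → ∃[ y ] (OneOf a b y × x ≢ y)
  oneOf-other {a} {b} a≢b (inj₁ refl) = b , inj₂ refl , a≢b
  oneOf-other {a} {b} a≢b (inj₂ refl) = a , inj₁ refl , λ e → a≢b (sym e)

  oneOf-≢-same : ∀ {a b x y z} → OneOf a b x → OneOf a b y → OneOf a b z →
                 x ≢ z → y ≢ z → x ≡ y
  oneOf-≢-same (inj₁ refl) (inj₁ refl) _           _   _   = refl
  oneOf-≢-same (inj₂ refl) (inj₂ refl) _           _   _   = refl
  oneOf-≢-same (inj₁ refl) (inj₂ refl) (inj₁ refl) x≢z _   = ⊥-elim (x≢z refl)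
  oneOf-≢-same (inj₁ refl) (inj₂ refl) (inj₂ refl) _   y≢z = ⊥-elim (y≢z refl)
  oneOf-≢-same (inj₂ refl) (inj₁ refl) (inj₁ refl) _   y≢z = ⊥-elim (y≢z refl)
  oneOf-≢-same (inj₂ refl) (inj₁ refl) (inj₂ refl) x≢z _   = ⊥-elim (x≢z refl)

  oneOf-¬≢⇒≡ : ∀ {a b x y} → a ≢ b → OneOf a b x → OneOf a b y → ¬ x ≢ y → x ≡ y
  oneOf-¬≢⇒≡ _   (inj₁ refl) (inj₁ refl) _    = refl
  oneOf-¬≢⇒≡ _   (inj₂ refl) (inj₂ refl) _    = refl
  oneOf-¬≢⇒≡ a≢b (inj₁ refl) (inj₂ refl) ¬x≢y = ⊥-elim (¬x≢y a≢b)
  oneOf-¬≢⇒≡ a≢b (inj₂ refl) (inj₁ refl) ¬x≢y = ⊥-elim (¬x≢y λ e → a≢b (sym e))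

-- lo i, mid i and up i are the positions of the faces of rank i - 1, i and i + 1
-- in a flag (position k holds the face of rank k - 1).
module Positions (n : ℕ) where

  lo mid up : Fin n → Fin (2 + n)
  lo i  = inject₁ (inject₁ i)
  mid i = Fin.suc (inject₁ i)
  up i  = Fin.suc (Fin.suc i)

  toℕ-lo : ∀ i → toℕ (lo i) ≡ toℕ i
  toℕ-lo i = trans (Finₚ.toℕ-inject₁ (inject₁ i)) (Finₚ.toℕ-inject₁ i)

  toℕ-mid : ∀ i → toℕ (mid i) ≡ suc (toℕ i)
  toℕ-mid i = cong suc (Finₚ.toℕ-inject₁ i)

  lo<mid : ∀ i → toℕ (lo i) ℕ.< toℕ (mid i)
  lo<mid i rewrite toℕ-lo i | toℕ-mid i = ℕₚ.n<1+n (toℕ i)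

  mid<up : ∀ i → toℕ (mid i) ℕ.< toℕ (up i)
  mid<up i rewrite toℕ-mid i = ℕₚ.n<1+n (suc (toℕ i))

  lo≢mid : ∀ i → lo i ≢ mid i
  lo≢mid i e = ℕₚ.<-irrefl (cong toℕ e) (lo<mid i)

  up≢mid : ∀ i → up i ≢ mid i
  up≢mid i e = ℕₚ.<-irrefl (cong toℕ (sym e)) (mid<up i)

  data Position : Fin (2 + n) → Set where
    bottom : Position Fin.zero
    middle : ∀ i → Position (mid i)
    top    : Position (fromℕ (suc n))

  position : ∀ p → Position p
  position Fin.zero    = bottom
  position (Fin.suc q) with view q
  ... | ‵fromℕ          = top
  ... | ‵inj₁ {i = i} _ = middle i

module FlagTheory {n : ℕ} (𝓟 : Polytope n) where

  open Polytope 𝓟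
  open GradedPoset poset
  open IsPartialOrder isPartialOrder using (reflexive)
    renaming (refl to ≤-refl; trans to ≤-trans)
  open Positions n

  𝓟Flag : Set
  𝓟Flag = PFlag 𝓟

  rk : Face → ℕ
  rk F = toℕ (rank F)

  rk-face : (X : 𝓟Flag) → ∀ k → rk (face X k) ≡ toℕ k
  rk-face X k = cong toℕ (face-rank X k)

  rk-min : rk minFace ≡ 0
  rk-min = cong toℕ rank-min

  rk-max : rk maxFace ≡ suc n
  rk-max = trans (cong toℕ rank-max) (Finₚ.toℕ-fromℕ (suc n))

  rk≢⇒≢ : ∀ {F G} → rk F ≢ rk G → F ≢ G
  rk≢⇒≢ rF≢rG F≡G = rF≢rG (cong rk F≡G)

  ≤∧rk<⇒< : ∀ {F G} → F ≤ G → rk F ℕ.< rk G → F < G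
  ≤∧rk<⇒< F≤G r< = F≤G , rk≢⇒≢ (ℕₚ.<⇒≢ r<)

  ≤⇒rk≤ : ∀ {F G} → F ≤ G → rk F ℕ.≤ rk G
  ≤⇒rk≤ {F} {G} F≤G with rk G ℕ.<? rk F
  ... | yes r> = ⊥-elim (ℕₚ.<-asym r> (rank-mono (F≤G , rk≢⇒≢ (λ e → ℕₚ.<⇒≢ r> (sym e)))))
  ... | no r≯ = ℕₚ.≮⇒≥ r≯

  rk-between : ∀ {L H U} → L < H → H < U → rk U ≡ 2 + rk L → rk H ≡ suc (rk L)
  rk-between L<H H<U rU = ℕₚ.≤-antisym
    (ℕₚ.≤-pred (subst (rk _ ℕ.<_) rU (rank-mono H<U))) (rank-mono L<H)

  face-< : (X : 𝓟Flag) → ∀ k l → toℕ k ℕ.< toℕ l → face X k < face X l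
  face-< X k l k<l = ≤∧rk<⇒< (face-mono X k l (ℕₚ.<⇒≤ k<l))
    (subst₂ ℕ._<_ (sym (rk-face X k)) (sym (rk-face X l)) k<l)

  -- Faces have no decidable equality, so at the extreme positions two flags are only
  -- known not to disagree; strong flag connectivity upgrades this to equality.
  Rigid : Fin (2 + n) → Set
  Rigid p = ∀ (X Y : 𝓟Flag) → ¬ face X p ≢ face Y p

  rigid-bottom : Rigid Fin.zero
  rigid-bottom X Y X≢Y = not-min X (λ X≡ → not-min Y (λ Y≡ → X≢Y (trans X≡ (sym Y≡))))
    where
      not-min : (Z : 𝓟Flag) → ¬ face Z Fin.zero ≢ minFace
      not-min Z Z≢min with rank-mono (minFace-≤ _ , λ e → Z≢min (sym e))
      ... | r< rewrite rank-min | face-rank Z Fin.zero = ℕₚ.n≮0 r<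

  rigid-top : Rigid (fromℕ (suc n))
  rigid-top X Y X≢Y = not-max X (λ X≡ → not-max Y (λ Y≡ → X≢Y (trans X≡ (sym Y≡))))
    where
      not-max : (Z : 𝓟Flag) → ¬ face Z (fromℕ (suc n)) ≢ maxFace
      not-max Z Z≢max with rank-mono (≤-maxFace _ , Z≢max)
      ... | r< rewrite rank-max | face-rank Z (fromℕ (suc n)) = ℕₚ.<-irrefl refl r<

  rigid-shared : ∀ {p} → Rigid p → (X Y : 𝓟Flag) → face X p ≡ face Y p
  rigid-shared {p} rigid X Y = along (sfc X Y)
    where
      along : ∀ {C X Y} → FlagPath poset C X Y → face X p ≡ face Y p
      along (done X≈Y)                  = X≈Y p
      along (next {X} {Z} (q , d) _ Z⇝Y) = trans (fixed q d) (along Z⇝Y)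
        where
          fixed : ∀ q → DiffersAt poset q X Z → face X p ≡ face Z p
          fixed q (differ , same) with q Finₚ.≟ p
          ... | yes refl = ⊥-elim (rigid X Z differ)
          ... | no q≢p   = same p (λ e → q≢p (sym e))

  adjacent⇒iAdjacent : ∀ {X Y} → Adjacent poset X Y → ∃[ i ] IAdj 𝓟 i X Y
  adjacent⇒iAdjacent {X} {Y} (p , d) with position p
  ... | bottom   = ⊥-elim (rigid-bottom X Y (proj₁ d))
  ... | middle i = i , d
  ... | top      = ⊥-elim (rigid-top X Y (proj₁ d))

  -- Flags through given faces

  coatom-between : ∀ d {L G} → L ≤ G → rk L ℕ.< rk G → rk G ℕ.≤ d + rk L →
                   ∃[ H ] (L ≤ H × H ≤ G × suc (rk H) ≡ rk G)
  coatom-between zero    L≤G r< bound = ⊥-elim (ℕₚ.<-irrefl refl (ℕₚ.<-≤-trans r< bound))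
  coatom-between (suc d) {L} {G} L≤G r< bound with suc (rk L) ℕ.≟ rk G
  ... | yes covers = L , ≤-refl , L≤G , covers
  ... | no ¬covers with graded (≤∧rk<⇒< L≤G r<) (ℕₚ.≤∧≢⇒< r< ¬covers)
  ...   | H , L<H , H<G with coatom-between d (proj₁ H<G) (rank-mono H<G) bound′
    where
      bound′ : rk G ℕ.≤ d + rk H
      bound′ = ℕₚ.≤-trans bound
        (subst (ℕ._≤ d + rk H) (ℕₚ.+-suc d (rk L)) (ℕₚ.+-monoʳ-≤ d (rank-mono L<H)))
  ...     | K , H≤K , K≤G , covers = K , ≤-trans (proj₁ L<H) H≤K , K≤G , covers

  step-down : ∀ {L H} → L ≤ H → ∃[ K ] (L ≤ K × K ≤ H × (rk L ℕ.< rk H → suc (rk K) ≡ rk H))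
  step-down {L} {H} L≤H with rk L ℕ.<? rk H
  ... | yes r< = let K , L≤K , K≤H , covers = coatom-between (rk H) L≤H r< (ℕₚ.m≤m+n (rk H) (rk L))
                 in K , L≤K , K≤H , λ _ → covers
  ... | no r≮  = H , L≤H , ≤-refl , λ r< → ⊥-elim (r≮ r<)

  record Chain (L U : Face) : Set where
    field
      at      : ℕ → Face
      above   : ∀ m → L ≤ at m
      below   : ∀ m → at m ≤ U
      mono    : ∀ {m m′} → m ℕ.≤ m′ → at m ≤ at m′
      at-rank : ∀ {m} → rk L ℕ.≤ m → m ℕ.≤ rk U → rk (at m) ≡ m

  module Descent {L U} (L≤U : L ≤ U) where

    Between : Set
    Between = ∃[ H ] (L ≤ H × H ≤ U)

    lower : Between → Between
    lower (H , L≤H , H≤U) = let K , L≤K , K≤H , _ = step-down L≤H in K , L≤K , ≤-trans K≤H H≤U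

    lower-≤ : ∀ b → proj₁ (lower b) ≤ proj₁ b
    lower-≤ (H , L≤H , _) = let _ , _ , K≤H , _ = step-down L≤H in K≤H

    lower-covers : ∀ b → rk L ℕ.< rk (proj₁ b) → suc (rk (proj₁ (lower b))) ≡ rk (proj₁ b)
    lower-covers (H , L≤H , _) = let _ , _ , _ , covers = step-down L≤H in covers

    down : ℕ → Between
    down zero    = U , L≤U , ≤-refl
    down (suc j) = lower (down j)

    face-down : ℕ → Face
    face-down j = proj₁ (down j)

    down-antitone : ∀ {j j′} → j ℕ.≤ j′ → face-down j′ ≤ face-down j
    down-antitone {j} {j′} j≤j′ =
      subst (λ x → face-down x ≤ face-down j) (ℕₚ.m∸n+n≡m j≤j′) (go (j′ ∸ j))
      where
        go : ∀ d → face-down (d + j) ≤ face-down j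
        go zero    = ≤-refl
        go (suc d) = ≤-trans (lower-≤ (down (d + j))) (go d)

    rk-down : ∀ j → j + rk L ℕ.≤ rk U → rk (face-down j) + j ≡ rk U
    rk-down zero    _     = ℕₚ.+-identityʳ (rk U)
    rk-down (suc j) bound = begin
      rk (face-down (suc j)) + suc j   ≡⟨ ℕₚ.+-suc _ j ⟩
      suc (rk (face-down (suc j))) + j ≡⟨ cong (_+ j) (lower-covers (down j) L<H) ⟩
      rk (face-down j) + j             ≡⟨ ih ⟩
      rk U                             ∎
      where
        open ≡-Reasoning
        ih : rk (face-down j) + j ≡ rk U
        ih = rk-down j (ℕₚ.≤-trans (ℕₚ.n≤1+n _) bound)
        L<H : rk L ℕ.< rk (face-down j)
        L<H = ℕₚ.+-cancelʳ-≤ j (suc (rk L)) (rk (face-down j))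
          (subst₂ ℕ._≤_ (cong suc (ℕₚ.+-comm j (rk L))) (sym ih) bound)

    chain : Chain L U
    chain = record
      { at      = λ m → face-down (rk U ∸ m)
      ; above   = λ m → proj₁ (proj₂ (down (rk U ∸ m)))
      ; below   = λ m → proj₂ (proj₂ (down (rk U ∸ m)))
      ; mono    = λ {m} {m′} m≤m′ → down-antitone (ℕₚ.∸-monoʳ-≤ (rk U) m≤m′)
      ; at-rank = at-rank
      }
      where
        at-rank : ∀ {m} → rk L ℕ.≤ m → m ℕ.≤ rk U → rk (face-down (rk U ∸ m)) ≡ m
        at-rank {m} L≤m m≤U = ℕₚ.+-cancelʳ-≡ (rk U ∸ m) _ m (trans
          (rk-down (rk U ∸ m)
            (ℕₚ.≤-trans (ℕₚ.+-monoʳ-≤ (rk U ∸ m) L≤m) (ℕₚ.≤-reflexive (ℕₚ.m∸n+n≡m m≤U))))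
          (sym (ℕₚ.m+[n∸m]≡n m≤U)))

    chain-top : Chain.at chain (rk U) ≡ U
    chain-top = cong face-down (ℕₚ.n∸n≡0 (rk U))

  module _ {L M U} (c₁ : Chain L M) (c₂ : Chain M U) where
    private
      module C₁ = Chain c₁
      module C₂ = Chain c₂

      pick : ∀ m → Dec (m ℕ.≤ rk M) → Face
      pick m (yes _) = C₁.at m
      pick m (no _)  = C₂.at m

      pick-mono : ∀ {m m′} (d : Dec (m ℕ.≤ rk M)) (d′ : Dec (m′ ℕ.≤ rk M)) →
                  m ℕ.≤ m′ → pick m d ≤ pick m′ d′
      pick-mono (yes _)   (yes _)    m≤m′ = C₁.mono m≤m′
      pick-mono {m} {m′} (yes _) (no _) _ = ≤-trans (C₁.below m) (C₂.above m′)
      pick-mono (no m≰M)  (yes m′≤M) m≤m′ = ⊥-elim (m≰M (ℕₚ.≤-trans m≤m′ m′≤M))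
      pick-mono (no _)    (no _)     m≤m′ = C₂.mono m≤m′

      pick-rank : ∀ {m} (d : Dec (m ℕ.≤ rk M)) → rk L ℕ.≤ m → m ℕ.≤ rk U → rk (pick m d) ≡ m
      pick-rank (yes m≤M) L≤m _   = C₁.at-rank L≤m m≤M
      pick-rank (no m≰M)  _   m≤U = C₂.at-rank (ℕₚ.<⇒≤ (ℕₚ.≰⇒> m≰M)) m≤U

    concat : Chain L U
    concat = record
      { at      = λ m → pick m (m ℕ.≤? rk M)
      ; above   = λ m → pick-above m (m ℕ.≤? rk M)
      ; below   = λ m → pick-below m (m ℕ.≤? rk M)
      ; mono    = λ {m} {m′} → pick-mono (m ℕ.≤? rk M) (m′ ℕ.≤? rk M)
      ; at-rank = λ {m} → pick-rank (m ℕ.≤? rk M)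
      }
      where
        pick-above : ∀ m d → L ≤ pick m d
        pick-above m (yes _) = C₁.above m
        pick-above m (no _)  = ≤-trans (≤-trans (C₁.above m) (C₁.below m)) (C₂.above m)
        pick-below : ∀ m d → pick m d ≤ U
        pick-below m (yes _) = ≤-trans (C₁.below m) (≤-trans (C₂.above m) (C₂.below m))
        pick-below m (no _)  = C₂.below m

    concat-left : ∀ {m} → m ℕ.≤ rk M → Chain.at concat m ≡ C₁.at m
    concat-left {m} m≤M with m ℕ.≤? rk M
    ... | yes _   = refl
    ... | no m≰M  = ⊥-elim (m≰M m≤M)

    concat-right : ∀ {m} → rk M ℕ.< m → Chain.at concat m ≡ C₂.at m
    concat-right {m} M<m with m ℕ.≤? rk M
    ... | yes m≤M = ⊥-elim (ℕₚ.<-irrefl refl (ℕₚ.<-≤-trans M<m m≤M))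
    ... | no _    = refl

  chain⇒flag : Chain minFace maxFace → 𝓟Flag
  chain⇒flag c = record
    { face      = λ k → at (toℕ k)
    ; face-rank = λ k → Finₚ.toℕ-injective (at-rank
        (subst (ℕ._≤ toℕ k) (sym rk-min) z≤n)
        (subst (toℕ k ℕ.≤_) (sym rk-max) (ℕₚ.≤-pred (Finₚ.toℕ<n k))))
    ; face-mono = λ k l → mono
    }
    where open Chain c

  module _ {F G} (F≤G : F ≤ G) where

    flagThrough : 𝓟Flag
    flagThrough = chain⇒flag (concat (concat (chain (minFace-≤ F)) (chain F≤G)) (chain (≤-maxFace G)))
      where open Descent using (chain)

    flagThrough-lower : face flagThrough (rank F) ≡ F
    flagThrough-lower =
      trans (concat-left _ _ (≤⇒rk≤ F≤G))
        (trans (concat-left _ _ ℕₚ.≤-refl) (Descent.chain-top (minFace-≤ F)))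

    flagThrough-upper : rk F ℕ.< rk G → face flagThrough (rank G) ≡ G
    flagThrough-upper F<G =
      trans (concat-left _ _ ℕₚ.≤-refl) (trans (concat-right _ _ F<G) (Descent.chain-top F≤G))

  flagAt : Face → 𝓟Flag
  flagAt F = flagThrough (≤-refl {F})

  flagAt-face : ∀ F → face (flagAt F) (rank F) ≡ F
  flagAt-face F = flagThrough-lower ≤-refl

  -- Diamonds and adjacent flags

  record Diamond (L U : Face) : Set where
    field
      h₁ h₂  : Face
      h₁≢h₂  : h₁ ≢ h₂
      inside : ∀ {H} → OneOf h₁ h₂ H → L < H × H < U
      covers : ∀ {H} → L < H → H < U → OneOf h₁ h₂ H

  toDiamond : ∀ {L U} → L ≤ U → rk U ≡ 2 + rk L → Diamond L U
  toDiamond {L} {U} L≤U rU with diamond L≤U rU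
  ... | h₁ , h₂ , h₁≢h₂ , in₁ , in₂ , covers = record
    { h₁ = h₁ ; h₂ = h₂ ; h₁≢h₂ = h₁≢h₂ ; inside = inside ; covers = λ {H} → covers H }
    where
      inside : ∀ {H} → OneOf h₁ h₂ H → L < H × H < U
      inside (inj₁ refl) = in₁
      inside (inj₂ refl) = in₂

  rk-lo : (X : 𝓟Flag) → ∀ i → rk (face X (lo i)) ≡ toℕ i
  rk-lo X i = trans (rk-face X (lo i)) (toℕ-lo i)

  flagAt-at : ∀ {F p} → rank F ≡ p → face (flagAt F) p ≡ F
  flagAt-at {F} refl = flagAt-face F

  -- F ≢ G would give rank F < rank G, so F and G are not apart. For a middle rank both
  -- lie in one diamond, whose two faces are distinct, and this makes them equal.
  ≤∧rank≡⇒≡ : ∀ {F G} → F ≤ G → rank F ≡ rank G → F ≡ G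
  ≤∧rank≡⇒≡ {F} {G} F≤G rank≡ = by-position (position (rank F)) refl
    where
      shared : ∀ {p} → Rigid p → rank F ≡ p → F ≡ G
      shared rigid refl = trans (sym (flagAt-face F))
        (trans (rigid-shared rigid (flagAt F) (flagAt G)) (flagAt-at (sym rank≡)))

      by-position : ∀ {p} → Position p → rank F ≡ p → F ≡ G
      by-position bottom     = shared rigid-bottom
      by-position top        = shared rigid-top
      by-position (middle i) rankF = oneOf-¬≢⇒≡ (Diamond.h₁≢h₂ D)
        (Diamond.covers D (≤∧rk<⇒< L≤F (L<mid rk-F)) (≤∧rk<⇒< (≤-trans F≤G G≤U) (mid<U rk-F)))
        (Diamond.covers D (≤∧rk<⇒< (≤-trans L≤F F≤G) (L<mid rk-G)) (≤∧rk<⇒< G≤U (mid<U rk-G)))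
        (λ F≢G → ℕₚ.<-irrefl (cong toℕ rank≡) (rank-mono (F≤G , F≢G)))
        where
          L U : Face
          L = face (flagAt F) (lo i)
          U = face (flagAt G) (up i)
          L≤F : L ≤ F
          L≤F = subst (L ≤_) (flagAt-at rankF) (face-mono (flagAt F) (lo i) (mid i) (ℕₚ.<⇒≤ (lo<mid i)))
          G≤U : G ≤ U
          G≤U = subst (_≤ U) (flagAt-at (trans (sym rank≡) rankF))
            (face-mono (flagAt G) (mid i) (up i) (ℕₚ.<⇒≤ (mid<up i)))
          rk-U : rk U ≡ 2 + rk L
          rk-U = trans (rk-face (flagAt G) (up i)) (cong (2 +_) (sym (rk-lo (flagAt F) i)))
          D : Diamond L U
          D = toDiamond (≤-trans L≤F (≤-trans F≤G G≤U)) rk-U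
          rk-F : rk F ≡ suc (toℕ i)
          rk-F = trans (cong toℕ rankF) (toℕ-mid i)
          rk-G : rk G ≡ suc (toℕ i)
          rk-G = trans (cong toℕ (sym rank≡)) rk-F
          L<mid : ∀ {H} → rk H ≡ suc (toℕ i) → rk L ℕ.< rk H
          L<mid rk-H = subst₂ ℕ._<_ (sym (rk-lo (flagAt F) i)) (sym rk-H) (ℕₚ.n<1+n (toℕ i))
          mid<U : ∀ {H} → rk H ≡ suc (toℕ i) → rk H ℕ.< rk U
          mid<U rk-H = subst₂ ℕ._<_ (sym rk-H) (sym (rk-face (flagAt G) (up i))) (ℕₚ.n<1+n (suc (toℕ i)))

  flagDiamond : (C : 𝓟Flag) (i : Fin n) → Diamond (face C (lo i)) (face C (up i))
  flagDiamond C i = toDiamond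
    (face-mono C (lo i) (up i) (ℕₚ.<⇒≤ (ℕₚ.<-trans (lo<mid i) (mid<up i))))
    (trans (rk-face C (up i)) (cong (2 +_) (sym (rk-lo C i))))

  InFlagDiamond : 𝓟Flag → Fin n → Face → Set
  InFlagDiamond C i = OneOf (Diamond.h₁ (flagDiamond C i)) (Diamond.h₂ (flagDiamond C i))

  mid-inFlagDiamond : ∀ (C X : 𝓟Flag) i → face X (lo i) ≡ face C (lo i) → face X (up i) ≡ face C (up i) →
              InFlagDiamond C i (face X (mid i))
  mid-inFlagDiamond C X i lo≡ up≡ = Diamond.covers (flagDiamond C i)
    (subst (_< face X (mid i)) lo≡ (face-< X (lo i) (mid i) (lo<mid i)))
    (subst (face X (mid i) <_) up≡ (face-< X (mid i) (up i) (mid<up i)))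

  module Exchange (C : 𝓟Flag) (i : Fin n) {H : Face}
    (H∈ : InFlagDiamond C i H) where

    private
      L<H×H<U : face C (lo i) < H × H < face C (up i)
      L<H×H<U = Diamond.inside (flagDiamond C i) H∈

      rank-H : rank H ≡ mid i
      rank-H = Finₚ.toℕ-injective (trans
        (rk-between (proj₁ L<H×H<U) (proj₂ L<H×H<U) (trans (rk-face C (up i)) (cong (2 +_) (sym (rk-lo C i)))))
        (trans (cong suc (rk-lo C i)) (sym (toℕ-mid i))))

      pick : ∀ k → Dec (k ≡ mid i) → Face
      pick k (yes _) = H
      pick k (no _)  = face C k

      pick-rank : ∀ k d → rank (pick k d) ≡ k
      pick-rank k (yes k≡) = trans rank-H (sym k≡)
      pick-rank k (no _)   = face-rank C k

      pick-mono : ∀ k l d d′ → k Fin.≤ l → pick k d ≤ pick l d′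
      pick-mono k l (yes _)    (yes _)    _   = ≤-refl
      pick-mono k l (yes refl) (no l≢)    k≤l =
        ≤-trans (proj₁ (proj₂ L<H×H<U)) (face-mono C (up i) l up≤l)
        where
          up≤l : toℕ (up i) ℕ.≤ toℕ l
          up≤l = subst (ℕ._< toℕ l) (toℕ-mid i) (ℕₚ.≤∧≢⇒< k≤l λ e → l≢ (sym (Finₚ.toℕ-injective e)))
      pick-mono k l (no k≢)    (yes refl) k≤l =
        ≤-trans (face-mono C k (lo i) k≤lo) (proj₁ (proj₁ L<H×H<U))
        where
          k≤lo : toℕ k ℕ.≤ toℕ (lo i)
          k≤lo = subst (toℕ k ℕ.≤_) (sym (toℕ-lo i))
            (ℕₚ.≤-pred (subst (toℕ k ℕ.<_) (toℕ-mid i) (ℕₚ.≤∧≢⇒< k≤l λ e → k≢ (Finₚ.toℕ-injective e))))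
      pick-mono k l (no _)     (no _)     k≤l = face-mono C k l k≤l

    flag : 𝓟Flag
    flag = record
      { face      = λ k → pick k (k Finₚ.≟ mid i)
      ; face-rank = λ k → pick-rank k (k Finₚ.≟ mid i)
      ; face-mono = λ k l → pick-mono k l (k Finₚ.≟ mid i) (l Finₚ.≟ mid i)
      }

    flag-mid : face flag (mid i) ≡ H
    flag-mid with mid i Finₚ.≟ mid i
    ... | yes _    = refl
    ... | no ≢mid  = ⊥-elim (≢mid refl)

    flag-other : ∀ k → k ≢ mid i → face flag k ≡ face C k
    flag-other k k≢ with k Finₚ.≟ mid i
    ... | yes k≡ = ⊥-elim (k≢ k≡)
    ... | no _   = refl

  -- The action of W on flags

  flagSetoid : Setoid 0ℓ 0ℓ
  flagSetoid = record
    { Carrier       = 𝓟Flag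
    ; _≈_           = _≈F_ poset
    ; isEquivalence = record
      { refl  = λ _ → refl
      ; sym   = λ X≈Y k → sym (X≈Y k)
      ; trans = λ X≈Y Y≈Z k → trans (X≈Y k) (Y≈Z k)
      }
    }

  open Setoid flagSetoid using (_≈_) renaming (refl to ≈-refl; trans to ≈-trans)

  private
    otherMid : ∀ (C : 𝓟Flag) i → ∃[ H ] (InFlagDiamond C i H × face C (mid i) ≢ H)
    otherMid C i = oneOf-other (Diamond.h₁≢h₂ (flagDiamond C i)) (mid-inFlagDiamond C C i refl refl)

  adj : Fin n → 𝓟Flag → 𝓟Flag
  adj i C = Exchange.flag C i (proj₁ (proj₂ (otherMid C i)))

  adj-iAdj : ∀ i C → IAdj 𝓟 i C (adj i C)
  adj-iAdj i C =
    (λ e → proj₂ (proj₂ (otherMid C i)) (trans e flag-mid)) , λ k k≢ → sym (flag-other k k≢)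
    where open Exchange C i (proj₁ (proj₂ (otherMid C i)))

  iAdj-unique : ∀ {i C X Y} → IAdj 𝓟 i C X → IAdj 𝓟 i C Y → X ≈ Y
  iAdj-unique {i} {C} {X} {Y} (X≢ , X≡) (Y≢ , Y≡) k with k Finₚ.≟ mid i
  ... | no k≢    = trans (sym (X≡ k k≢)) (Y≡ k k≢)
  ... | yes refl = oneOf-≢-same
    (mid-inFlagDiamond C X i (sym (X≡ (lo i) (lo≢mid i))) (sym (X≡ (up i) (up≢mid i))))
    (mid-inFlagDiamond C Y i (sym (Y≡ (lo i) (lo≢mid i))) (sym (Y≡ (up i) (up≢mid i))))
    (mid-inFlagDiamond C C i refl refl) (λ e → X≢ (sym e)) (λ e → Y≢ (sym e))

  iAdj-sym : ∀ {i X Y} → IAdj 𝓟 i X Y → IAdj 𝓟 i Y X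
  iAdj-sym (X≢ , X≡) = (λ e → X≢ (sym e)) , λ k k≢ → sym (X≡ k k≢)

  iAdj-resp-≈ : ∀ {i X X′ Y Y′} → X ≈ X′ → Y ≈ Y′ → IAdj 𝓟 i X Y → IAdj 𝓟 i X′ Y′
  iAdj-resp-≈ {i} X≈ Y≈ (X≢ , X≡) =
    (λ e → X≢ (trans (X≈ (mid i)) (trans e (sym (Y≈ (mid i)))))) ,
    λ k k≢ → trans (sym (X≈ k)) (trans (X≡ k k≢) (Y≈ k))

  iAdj⇒≈adj : ∀ {i} X {Y} → IAdj 𝓟 i X Y → Y ≈ adj i X
  iAdj⇒≈adj {i} X {Y} d = iAdj-unique {i} {X} {Y} {adj i X} d (adj-iAdj i X)

  adj-cong : ∀ i {X Y} → X ≈ Y → adj i X ≈ adj i Y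
  adj-cong i {X} {Y} X≈Y =
    iAdj⇒≈adj Y {adj i X} (iAdj-resp-≈ {i} {X} {Y} {adj i X} {adj i X} X≈Y (λ _ → refl) (adj-iAdj i X))

  adj-involutive : ∀ i X → adj i (adj i X) ≈ X
  adj-involutive i X k = sym (iAdj⇒≈adj (adj i X) {X} (iAdj-sym {i} {X} {adj i X} (adj-iAdj i X)) k)

  infixr 5 _·_

  _·_ : List (Fin n) → 𝓟Flag → 𝓟Flag
  []      · X = X
  (i ∷ w) · X = adj i (w · X)

  ·-cong : ∀ w {X Y} → X ≈ Y → w · X ≈ w · Y
  ·-cong []      X≈Y = X≈Y
  ·-cong (i ∷ w) X≈Y = adj-cong i (·-cong w X≈Y)

  ·-++ : ∀ v u X → (v ++ u) · X ≡ v · u · X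
  ·-++ []      u X = refl
  ·-++ (i ∷ v) u X = cong (adj i) (·-++ v u X)

  reverse-∷-· : ∀ i w X → reverse (i ∷ w) · X ≡ reverse w · adj i X
  reverse-∷-· i w X = trans (cong (_· X) (Listₚ.unfold-reverse i w)) (·-++ (reverse w) [ i ] X)

  reverse-·-cancel : ∀ w X → reverse w · w · X ≈ X
  reverse-·-cancel []      X = ≈-refl {X}
  reverse-·-cancel (i ∷ w) X = begin
    reverse (i ∷ w) · adj i (w · X)    ≡⟨ reverse-∷-· i w (adj i (w · X)) ⟩
    reverse w · adj i (adj i (w · X))  ≈⟨ ·-cong (reverse w) (adj-involutive i (w · X)) ⟩
    reverse w · w · X                  ≈⟨ reverse-·-cancel w X ⟩
    X                                  ∎
    where open SetoidReasoning flagSetoid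

  ·-reverse-cancel : ∀ w X → w · reverse w · X ≈ X
  ·-reverse-cancel w X =
    subst (λ v → v · reverse w · X ≈ X) (Listₚ.reverse-involutive w) (reverse-·-cancel (reverse w) X)

  acts⇒· : ∀ w {X Y} → Acts 𝓟 w X Y → w · X ≈ Y
  acts⇒· []      X≈Y             = X≈Y
  acts⇒· (i ∷ w) {X} {Y} (Z , wX≈Z , d) =
    ≈-trans {adj i (w · X)} {adj i Z} {Y}
      (adj-cong i (acts⇒· w {X} {Z} wX≈Z)) (λ k → sym (iAdj⇒≈adj Z {Y} d k))

  ·⇒acts : ∀ w {X Y} → w · X ≈ Y → Acts 𝓟 w X Y
  ·⇒acts []      wX≈Y = wX≈Y
  ·⇒acts (i ∷ w) {X} {Y} wX≈Y =
    w · X , ·⇒acts w (≈-refl {w · X}) ,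
    iAdj-resp-≈ {i} {w · X} {w · X} {adj i (w · X)} {Y} (≈-refl {w · X}) wX≈Y (adj-iAdj i (w · X))

  Avoids : Fin (2 + n) → List (Fin n) → Set
  Avoids p = All (λ i → mid i ≢ p)

  avoids-fixes : ∀ {p} w X → Avoids p w → face (w · X) p ≡ face X p
  avoids-fixes     []      X []          = refl
  avoids-fixes {p} (i ∷ w) X (i≢p ∷ avoids) =
    trans (sym (proj₂ (adj-iAdj i (w · X)) p (λ e → i≢p (sym e)))) (avoids-fixes w X avoids)

  path⇒word : ∀ {C X Y} p → (∀ {Z} → C Z → face Z p ≡ face X p) → FlagPath poset C X Y →
              ∃[ u ] (Avoids p u × u · X ≈ Y)
  path⇒word p _ (done X≈Y) = [] , [] , X≈Y
  path⇒word {X = X} {Y} p fixed (next {Y = W} X~W CW W⇝Y)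
    with adjacent⇒iAdjacent {X} {W} X~W | path⇒word p (λ CZ → trans (fixed CZ) (sym (fixed CW))) W⇝Y
  ... | i , d | u , avoids , uW≈Y = u ++ [ i ] , Allₚ.++⁺ avoids (i≢p ∷ []) , (begin
    (u ++ [ i ]) · X ≡⟨ ·-++ u [ i ] X ⟩
    u · adj i X      ≈⟨ ·-cong u (λ k → sym (iAdj⇒≈adj X {W} d k)) ⟩
    u · W            ≈⟨ uW≈Y ⟩
    Y                ∎)
    where
      open SetoidReasoning flagSetoid
      i≢p : mid i ≢ p
      i≢p refl = proj₁ d (sym (fixed CW))

  connected-fixing : ∀ (X Y : 𝓟Flag) p → face X p ≡ face Y p → ∃[ u ] (Avoids p u × u · X ≈ Y)
  connected-fixing X Y p X≡Y = path⇒word p (λ CZ → CZ p X≡Y) (sfc X Y)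

  connected : ∀ (X Y : 𝓟Flag) → ∃[ u ] u · X ≈ Y
  connected X Y with connected-fixing X Y Fin.zero (rigid-shared rigid-bottom X Y)
  ... | u , _ , uX≈Y = u , uX≈Y

  Aut : Set
  Aut = Automorphism poset

  module _ (γ : Aut) where
    open Automorphism γ

    fun-injective : ∀ {F G} → fun F ≡ fun G → F ≡ G
    fun-injective {F} {G} e = trans (sym (inv-l F)) (trans (cong inv e) (inv-l G))

    fun-strict : ∀ {F G} → F < G → fun F < fun G
    fun-strict (F≤G , F≢G) = mono F≤G , λ e → F≢G (fun-injective e)

  Aut-id : Aut
  Aut-id = record
    { fun = λ F → F ; inv = λ F → F ; inv-l = λ _ → refl ; inv-r = λ _ → refl
    ; mono = λ F≤G → F≤G ; reflect = λ F≤G → F≤G }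

  Aut-inverse : Aut → Aut
  Aut-inverse γ = record
    { fun = inv ; inv = fun ; inv-l = inv-r ; inv-r = inv-l
    ; mono    = λ {F} {G} F≤G → reflect (subst₂ _≤_ (sym (inv-r F)) (sym (inv-r G)) F≤G)
    ; reflect = λ {F} {G} F≤G → subst₂ _≤_ (inv-r F) (inv-r G) (mono F≤G)
    }
    where open Automorphism γ

  Aut-∘ : Aut → Aut → Aut
  Aut-∘ δ γ = record
    { fun     = λ F → δ.fun (γ.fun F)
    ; inv     = λ F → γ.inv (δ.inv F)
    ; inv-l   = λ F → trans (cong γ.inv (δ.inv-l _)) (γ.inv-l F)
    ; inv-r   = λ F → trans (cong δ.fun (γ.inv-r _)) (δ.inv-r F)
    ; mono    = λ F≤G → δ.mono (γ.mono F≤G)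
    ; reflect = λ F≤G → γ.reflect (δ.reflect F≤G)
    }
    where
      module δ = Automorphism δ
      module γ = Automorphism γ

  strict⇒rk≥ : (h : Face → Face) → (∀ {F G} → F < G → h F < h G) →
               (X : 𝓟Flag) → ∀ k → toℕ k ℕ.≤ rk (h (face X k))
  strict⇒rk≥ h strict X k = go (toℕ k) k refl
    where
      go : ∀ m k → toℕ k ≡ m → m ℕ.≤ rk (h (face X k))
      go zero    _           _ = z≤n
      go (suc m) (Fin.suc j) e = ℕₚ.≤-<-trans
        (go m (inject₁ j) (trans (Finₚ.toℕ-inject₁ j) (ℕₚ.suc-injective e)))
        (rank-mono (strict (face-< X (inject₁ j) (Fin.suc j)
          (subst (ℕ._< suc (toℕ j)) (sym (Finₚ.toℕ-inject₁ j)) (ℕₚ.n<1+n (toℕ j))))))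

  rank-fun : (γ : Aut) → ∀ F → rank (Automorphism.fun γ F) ≡ rank F
  rank-fun γ F = Finₚ.toℕ-injective (ℕₚ.≤-antisym
    (subst (λ H → rk (fun F) ℕ.≤ rk H) (inv-l F)
      (subst (λ H → rk (fun F) ℕ.≤ rk (inv H)) (flagAt-face (fun F))
        (strict⇒rk≥ inv (fun-strict (Aut-inverse γ)) (flagAt (fun F)) (rank (fun F)))))
    (subst (λ H → rk F ℕ.≤ rk (fun H)) (flagAt-face F)
      (strict⇒rk≥ fun (fun-strict γ) (flagAt F) (rank F))))
    where open Automorphism γ

  infixr 5 _⟨$⟩_

  _⟨$⟩_ : Aut → 𝓟Flag → 𝓟Flag
  γ ⟨$⟩ X = record
    { face      = λ k → fun (face X k)
    ; face-rank = λ k → trans (rank-fun γ (face X k)) (face-rank X k)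
    ; face-mono = λ k l k≤l → mono (face-mono X k l k≤l)
    }
    where open Automorphism γ

  ⟨$⟩-cong : ∀ γ {X Y} → X ≈ Y → γ ⟨$⟩ X ≈ γ ⟨$⟩ Y
  ⟨$⟩-cong γ X≈Y k = cong (Automorphism.fun γ) (X≈Y k)

  ⟨$⟩-iAdj : ∀ γ {i X Y} → IAdj 𝓟 i X Y → IAdj 𝓟 i (γ ⟨$⟩ X) (γ ⟨$⟩ Y)
  ⟨$⟩-iAdj γ (X≢Y , X≡Y) =
    (λ e → X≢Y (fun-injective γ e)) , λ k k≢ → cong (Automorphism.fun γ) (X≡Y k k≢)

  ⟨$⟩-· : ∀ γ w X → γ ⟨$⟩ w · X ≈ w · γ ⟨$⟩ X
  ⟨$⟩-· γ []      X = ≈-refl {γ ⟨$⟩ X}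
  ⟨$⟩-· γ (i ∷ w) X = begin
    γ ⟨$⟩ adj i (w · X)  ≈⟨ iAdj⇒≈adj (γ ⟨$⟩ w · X) {γ ⟨$⟩ adj i (w · X)} γ-adj ⟩
    adj i (γ ⟨$⟩ w · X)  ≈⟨ adj-cong i (⟨$⟩-· γ w X) ⟩
    adj i (w · γ ⟨$⟩ X)  ∎
    where
      open SetoidReasoning flagSetoid
      γ-adj : IAdj 𝓟 i (γ ⟨$⟩ w · X) (γ ⟨$⟩ adj i (w · X))
      γ-adj = ⟨$⟩-iAdj γ {i} {w · X} {adj i (w · X)} (adj-iAdj i (w · X))

  -- Orbits and stabilisers

  ≈⇒sameOrbit : ∀ {X Y} → X ≈ Y → SameOrbit 𝓟 X Y
  ≈⇒sameOrbit X≈Y = Aut-id , X≈Y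

  sameOrbit-refl : ∀ X → SameOrbit 𝓟 X X
  sameOrbit-refl X = ≈⇒sameOrbit {X} {X} (≈-refl {X})

  sameOrbit-sym : ∀ {X Y} → SameOrbit 𝓟 X Y → SameOrbit 𝓟 Y X
  sameOrbit-sym (γ , γX≈Y) = Aut-inverse γ , λ k → trans (cong inv (sym (γX≈Y k))) (inv-l _)
    where open Automorphism γ

  sameOrbit-trans : ∀ {X Y Z} → SameOrbit 𝓟 X Y → SameOrbit 𝓟 Y Z → SameOrbit 𝓟 X Z
  sameOrbit-trans (γ , γX≈Y) (δ , δY≈Z) =
    Aut-∘ δ γ , λ k → trans (cong (Automorphism.fun δ) (γX≈Y k)) (δY≈Z k)

  sameOrbit-· : ∀ w {X Y} → SameOrbit 𝓟 X Y → SameOrbit 𝓟 (w · X) (w · Y)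
  sameOrbit-· w {X} {Y} (γ , γX≈Y) =
    γ , ≈-trans {γ ⟨$⟩ w · X} {w · γ ⟨$⟩ X} {w · Y} (⟨$⟩-· γ w X) (·-cong w γX≈Y)

  SameStab : 𝓟Flag → 𝓟Flag → Set
  SameStab X Y = ∀ u → InStab 𝓟 u X ⇔ InStab 𝓟 u Y

  ·-++-++ : ∀ a b c X → (a ++ b ++ c) · X ≡ a · b · c · X
  ·-++-++ a b c X = trans (·-++ a (b ++ c) X) (cong (a ·_) (·-++ b c X))

  inStab-conjugate : ∀ w u Φ → InStab 𝓟 (w ++ u ++ reverse w) Φ ⇔ InStab 𝓟 u (reverse w · Φ)
  inStab-conjugate w u Φ = mk⇔
    (λ s → ·⇒acts u (conj⇒ (subst (_≈ Φ) (·-++-++ w u (reverse w) Φ) (acts⇒· (w ++ u ++ reverse w) s))))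
    (λ s → ·⇒acts (w ++ u ++ reverse w)
             (subst (_≈ Φ) (sym (·-++-++ w u (reverse w) Φ)) (conj⇐ (acts⇒· u s))))
    where
      open SetoidReasoning flagSetoid
      Y : 𝓟Flag
      Y = reverse w · Φ
      conj⇒ : w · u · Y ≈ Φ → u · Y ≈ Y
      conj⇒ wuY≈Φ = begin
        u · Y                 ≈⟨ reverse-·-cancel w (u · Y) ⟨
        reverse w · w · u · Y ≈⟨ ·-cong (reverse w) wuY≈Φ ⟩
        Y                     ∎
      conj⇐ : u · Y ≈ Y → w · u · Y ≈ Φ
      conj⇐ uY≈Y = begin
        w · u · Y ≈⟨ ·-cong w uY≈Y ⟩
        w · Y     ≈⟨ ·-reverse-cancel w Φ ⟩
        Φ         ∎

  conjStab⇔sameStab : ∀ w Φ Φ′ → ConjStab 𝓟 w Φ Φ′ ⇔ SameStab (reverse w · Φ) Φ′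
  conjStab⇔sameStab w Φ Φ′ = mk⇔
    (λ conj u → ⇔-trans (⇔-sym (inStab-conjugate w u Φ)) (conj u))
    (λ same u → ⇔-trans (inStab-conjugate w u Φ) (same u))

  sameOrbit⇒inStab : ∀ {X Y} → SameOrbit 𝓟 X Y → ∀ u → InStab 𝓟 u X → InStab 𝓟 u Y
  sameOrbit⇒inStab {X} {Y} (γ , γX≈Y) u uX = ·⇒acts u (begin
    u · Y           ≈⟨ ·-cong u γX≈Y ⟨
    u · γ ⟨$⟩ X     ≈⟨ ⟨$⟩-· γ u X ⟨
    γ ⟨$⟩ u · X     ≈⟨ ⟨$⟩-cong γ {u · X} {X} (acts⇒· u {X} {X} uX) ⟩
    γ ⟨$⟩ X         ≈⟨ γX≈Y ⟩
    Y               ∎)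
    where open SetoidReasoning flagSetoid

  sameOrbit⇒sameStab : ∀ {X Y} → SameOrbit 𝓟 X Y → SameStab X Y
  sameOrbit⇒sameStab {X} {Y} orbit u =
    mk⇔ (sameOrbit⇒inStab orbit u) (sameOrbit⇒inStab (sameOrbit-sym {X} {Y} orbit) u)

  module OrbitFromStabilizer {A B : 𝓟Flag} (same : SameStab A B) where

    agree : ∀ p w v → face (w · A) p ≡ face (v · A) p → face (w · B) p ≡ face (v · B) p
    agree p w v eq with connected-fixing (w · A) (v · A) p eq
    ... | u , avoids , uwA≈vA = trans (sym (avoids-fixes u (w · B) avoids)) (uwB≈vB p)
      where
        open SetoidReasoning flagSetoid
        word : List (Fin n)
        word = reverse v ++ u ++ w
        stabA : word · A ≈ A
        stabA = begin
          word · A              ≡⟨ ·-++-++ (reverse v) u w A ⟩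
          reverse v · u · w · A ≈⟨ ·-cong (reverse v) uwA≈vA ⟩
          reverse v · v · A     ≈⟨ reverse-·-cancel v A ⟩
          A                     ∎
        stabB : word · B ≈ B
        stabB = acts⇒· word (Equivalence.to (same word) (·⇒acts word stabA))
        uwB≈vB : u · w · B ≈ v · B
        uwB≈vB = begin
          u · w · B                 ≈⟨ ·-reverse-cancel v (u · w · B) ⟨
          v · reverse v · u · w · B ≡⟨ cong (v ·_) (·-++-++ (reverse v) u w B) ⟨
          v · word · B              ≈⟨ ·-cong v stabB ⟩
          v · B                     ∎

    wordTo : Face → List (Fin n)
    wordTo F = proj₁ (connected A (flagAt F))

    map : Face → Face
    map F = face (wordTo F · B) (rank F)

    map-face : ∀ (X : 𝓟Flag) w → w · A ≈ X → ∀ k → map (face X k) ≡ face (w · B) k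
    map-face X w wA≈X k = trans (agree r (wordTo F) w wordA≡wA) (cong (face (w · B)) (face-rank X k))
      where
        F : Face
        F = face X k
        r : Fin (2 + n)
        r = rank F
        wordA≡wA : face (wordTo F · A) r ≡ face (w · A) r
        wordA≡wA = begin
          face (wordTo F · A) r ≡⟨ proj₂ (connected A (flagAt F)) r ⟩
          face (flagAt F) r     ≡⟨ flagAt-face F ⟩
          face X k              ≡⟨ cong (face X) (face-rank X k) ⟨
          face X r              ≡⟨ wA≈X r ⟨
          face (w · A) r        ∎
          where open ≡-Reasoning

    map-mono : ∀ {F G} → F ≤ G → map F ≤ map G
    map-mono {F} {G} F≤G with rk F ℕ.<? rk G
    ... | no F≮G = reflexive (cong map (≤∧rank≡⇒≡ F≤G
            (Finₚ.toℕ-injective (ℕₚ.≤-antisym (≤⇒rk≤ F≤G) (ℕₚ.≮⇒≥ F≮G)))))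
    ... | yes F<G = subst₂ _≤_ (map-at (flagThrough-lower F≤G)) (map-at (flagThrough-upper F≤G F<G))
            (face-mono (w · B) (rank F) (rank G) (ℕₚ.<⇒≤ F<G))
      where
        Z : 𝓟Flag
        Z = flagThrough F≤G
        w : List (Fin n)
        w = proj₁ (connected A Z)
        map-at : ∀ {H} → face Z (rank H) ≡ H → face (w · B) (rank H) ≡ map H
        map-at {H} Z≡H = trans (sym (map-face Z w (proj₂ (connected A Z)) (rank H))) (cong map Z≡H)

  map-inverse : ∀ {A B} (same : SameStab A B) (same′ : SameStab B A) F →
                OrbitFromStabilizer.map same′ (OrbitFromStabilizer.map same F) ≡ F
  map-inverse {A} {B} same same′ F = trans
    (BA.map-face (AB.wordTo F · B) (AB.wordTo F) (≈-refl {AB.wordTo F · B}) (rank F))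
    (trans (proj₂ (connected A (flagAt F)) (rank F)) (flagAt-face F))
    where
      module AB = OrbitFromStabilizer same
      module BA = OrbitFromStabilizer same′

  sameStab⇒sameOrbit : ∀ {A B} → SameStab A B → SameOrbit 𝓟 A B
  sameStab⇒sameOrbit {A} {B} same = γ , AB.map-face A [] (≈-refl {A})
    where
      same′ : SameStab B A
      same′ u = ⇔-sym (same u)
      module AB = OrbitFromStabilizer same
      module BA = OrbitFromStabilizer same′
      γ : Aut
      γ = record
        { fun     = AB.map
        ; inv     = BA.map
        ; inv-l   = map-inverse same same′
        ; inv-r   = map-inverse same′ same
        ; mono    = AB.map-mono
        ; reflect = λ {F} {G} F≤G →
            subst₂ _≤_ (map-inverse same same′ F) (map-inverse same same′ G) (BA.map-mono F≤G)
        }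

  sameStab⇔sameOrbit : ∀ {X Y} → SameStab X Y ⇔ SameOrbit 𝓟 X Y
  sameStab⇔sameOrbit = mk⇔ sameStab⇒sameOrbit sameOrbit⇒sameStab

  conjStab⇔sameOrbit : ∀ w Φ Φ′ → ConjStab 𝓟 w Φ Φ′ ⇔ SameOrbit 𝓟 (reverse w · Φ) Φ′
  conjStab⇔sameOrbit w Φ Φ′ = ⇔-trans (conjStab⇔sameStab w Φ Φ′) sameStab⇔sameOrbit

  tEdge-adj : ∀ i X → TEdge 𝓟 i X (adj i X)
  tEdge-adj i X = X , adj i X , sameOrbit-refl X , adj-iAdj i X , sameOrbit-refl (adj i X)

  tEdge⇒sameOrbit : ∀ {i X Y} → TEdge 𝓟 i X Y → SameOrbit 𝓟 (adj i X) Y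
  tEdge⇒sameOrbit {i} {X} {Y} (X′ , Y′ , X~X′ , d , Y′~Y) =
    sameOrbit-trans {adj i X} {adj i X′} {Y} (sameOrbit-· [ i ] {X} {X′} X~X′)
      (sameOrbit-trans {adj i X′} {Y′} {Y}
        (≈⇒sameOrbit {adj i X′} {Y′} (λ k → sym (iAdj⇒≈adj X′ {Y′} d k))) Y′~Y)

  sameOrbit-reverse-∷ : ∀ {i X Y Z} w → TEdge 𝓟 i X Y → SameOrbit 𝓟 (reverse w · Y) Z →
                        SameOrbit 𝓟 (reverse (i ∷ w) · X) Z
  sameOrbit-reverse-∷ {i} {X} {Y} {Z} w edge orbit =
    subst (λ V → SameOrbit 𝓟 V Z) (sym (reverse-∷-· i w X))
    (sameOrbit-trans {reverse w · adj i X} {reverse w · Y} {Z}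
      (sameOrbit-· (reverse w) {adj i X} {Y} (tEdge⇒sameOrbit {i} {X} {Y} edge)) orbit)

module _ {n : ℕ} (𝓟 𝓠 : Polytope n) where

  private
    module P = FlagTheory 𝓟
    module Q = FlagTheory 𝓠

  dPath⇒ : ∀ {Φ Ψ Φ′ Ψ′} → DPath 𝓟 𝓠 (Φ , Ψ) (Φ′ , Ψ′) →
           ∃[ w ] (SameOrbit 𝓟 (reverse w P.· Φ) Φ′ × SameOrbit 𝓠 (reverse w Q.· Ψ) Ψ′)
  dPath⇒ (stay Φ~Φ′ Ψ~Ψ′) = [] , Φ~Φ′ , Ψ~Ψ′
  dPath⇒ {Φ} {Ψ} {Φ′} {Ψ′} (step {b = Φ₂ , Ψ₂} i (edge₁ , edge₂) rest) with dPath⇒ rest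
  ... | w , orbit₁ , orbit₂ =
    i ∷ w , P.sameOrbit-reverse-∷ {i} {Φ} {Φ₂} {Φ′} w edge₁ orbit₁
          , Q.sameOrbit-reverse-∷ {i} {Ψ} {Ψ₂} {Ψ′} w edge₂ orbit₂

  walk : ∀ v {Φ Ψ c} → DPath 𝓟 𝓠 (v P.· Φ , v Q.· Ψ) c → DPath 𝓟 𝓠 (Φ , Ψ) c
  walk []      path = path
  walk (i ∷ v) {Φ} {Ψ} path = walk v (step i (P.tEdge-adj i (v P.· Φ) , Q.tEdge-adj i (v Q.· Ψ)) path)

  dPath⇔ : ∀ {Φ Ψ Φ′ Ψ′} → DPath 𝓟 𝓠 (Φ , Ψ) (Φ′ , Ψ′) ⇔
           (∃[ w ] (SameOrbit 𝓟 (reverse w P.· Φ) Φ′ × SameOrbit 𝓠 (reverse w Q.· Ψ) Ψ′))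
  dPath⇔ = mk⇔ dPath⇒ λ (w , orbit₁ , orbit₂) → walk (reverse w) (stay orbit₁ orbit₂)

mainTheorem7 : ∀ {n : ℕ} (𝓟 𝓠 : Polytope n) (Φ Φ' : PFlag 𝓟) (Ψ Ψ' : PFlag 𝓠) →
    DPath 𝓟 𝓠 (Φ , Ψ) (Φ' , Ψ') ⇔
      (∃[ w ] (ConjStab 𝓟 w Φ Φ' × ConjStab 𝓠 w Ψ Ψ'))
mainTheorem7 𝓟 𝓠 Φ Φ′ Ψ Ψ′ = ⇔-trans (dPath⇔ 𝓟 𝓠) (mk⇔
  (λ (w , orbit₁ , orbit₂) → w , from (conj𝓟 w) orbit₁ , from (conj𝓠 w) orbit₂)
  (λ (w , conj₁ , conj₂) → w , to (conj𝓟 w) conj₁ , to (conj𝓠 w) conj₂))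
  where
    module P = FlagTheory 𝓟
    module Q = FlagTheory 𝓠
    open Equivalence
    conj𝓟 : ∀ w → ConjStab 𝓟 w Φ Φ′ ⇔ SameOrbit 𝓟 (reverse w P.· Φ) Φ′
    conj𝓟 w = P.conjStab⇔sameOrbit w Φ Φ′
    conj𝓠 : ∀ w → ConjStab 𝓠 w Ψ Ψ′ ⇔ SameOrbit 𝓠 (reverse w Q.· Ψ) Ψ′
    conj𝓠 w = Q.conjStab⇔sameOrbit w Ψ Ψ′
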